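{- Let $(P,\mathcal{D})$ be a tight structured ordered set and let $C,D\in\mathcal{D}$ be such that $C\upharpoonleft D$. Then $\gcd(|C|,|D|)>1$.
   Context: Ordered sets are finite. A dictated orbit structure for $P$ is a partition $\mathcal{D}$ of $P$ into antichains; $(P,\mathcal{D})$ is a structured ordered set. $\mathrm{Aut}_{\mathcal{D}}(P)$ is the group of automorphisms $\Phi$ of $P$ such that every orbit of $\langle\Phi\rangle$ is contained in a single member of $\mathcal{D}$. A nonempty $A\subseteq P$ is order-autonomous iff for all $z\in P\setminus A$: $z<a$ for some $a\in A$ implies $z<a'$ for all $a'\in A$, and $z>a$ for some $a\in A$ implies $z>a'$ for all $a'\in A$; nontrivial iff $|A|\notin\{1,|P|\}$. $(P,\mathcal{D})$ is tight iff no member of $\mathcal{D}$ contains a nontrivial order-autonomous antichain of $P$ and $\mathrm{Aut}_{\mathcal{D}}(P)$ acts transitively on every member of $\mathcal{D}$. For $C,D\in\mathcal{D}$, $C\upharpoonleft D$ means there are $c_1\in C,d_1\in D$ with $c_1<d_1$ and there are $c_2\in C,d_2\in D$ that are incomparable. -}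

module Defs where

open import Data.Nat using (ℕ; zero; suc)
open import Data.Fin using (Fin; _≟_)
open import Data.Fin.Subset using (Subset; _∈_; ∣_∣)
open import Data.List using (List; length; filter)
open import Data.List using () renaming (allFin to allFinL)
open import Data.Product using (Σ; _×_; ∃)
open import Relation.Nullary using (¬_)
open import Relation.Binary.PropositionalEquality using (_≡_; _≢_)
open import Relation.Binary.Structures using (IsStrictPartialOrder)
open import Function using (_∘_)

record FinOrderedSet : Set₁ where
  field
    size    : ℕ
    _<_     : Fin size → Fin size → Set
    isSPO   : IsStrictPartialOrder _≡_ _<_

-- The partition 𝒟 into antichains is
-- given by a surjective labelling  blk : Fin size → Fin blocks ; the
-- members of 𝒟 are the (nonempty) fibres of blk, each an antichain.
record StructuredOrderedSet : Set₁ where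
  field
    P       : FinOrderedSet
  open FinOrderedSet P public
  field
    blocks    : ℕ
    blk       : Fin size → Fin blocks
    blk-surj  : (i : Fin blocks) → ∃ λ x → blk x ≡ i
    antichain : ∀ x y → blk x ≡ blk y → ¬ (x < y)

iterate : ∀ {A : Set} → (A → A) → ℕ → A → A
iterate f zero    x = x
iterate f (suc m) x = f (iterate f m x)

module _ (S : StructuredOrderedSet) where
  open StructuredOrderedSet S

  Member : Fin blocks → Fin size → Set
  Member i x = blk x ≡ i

  card : Fin blocks → ℕ
  card i = length (filter (λ x → blk x ≟ i) (allFinL size))

  record Automorphism : Set where
    field
      fun      : Fin size → Fin size
      inv      : Fin size → Fin size
      inv-left : ∀ x → inv (fun x) ≡ x
      inv-right : ∀ x → fun (inv x) ≡ x
      pres     : ∀ x y → x < y → fun x < fun y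
      refl'    : ∀ x y → fun x < fun y → x < y

  -- Φ ∈ Aut_𝒟(P): every orbit of ⟨Φ⟩ lies in a single member of 𝒟
  -- (on a finite set, the orbit of x under ⟨Φ⟩ is {Φ^m x | m ∈ ℕ}).
  InAutD : Automorphism → Set
  InAutD Φ = ∀ x m → blk (iterate (Automorphism.fun Φ) m x) ≡ blk x

  OrderAutonomous : Subset size → Set
  OrderAutonomous A =
    (∃ λ a → a ∈ A) ×
    (∀ z → ¬ (z ∈ A) →
      (∀ a a′ → a ∈ A → a′ ∈ A → z < a → z < a′) ×
      (∀ a a′ → a ∈ A → a′ ∈ A → a < z → a′ < z))

  Nontrivial : Subset size → Set
  Nontrivial A = (∣ A ∣ ≢ 1) × (∣ A ∣ ≢ size)

  IsAntichain : Subset size → Set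
  IsAntichain A = ∀ a b → a ∈ A → b ∈ A → ¬ (a < b)

  Tight : Set
  Tight =
    (∀ (i : Fin blocks) (A : Subset size) →
       (∀ a → a ∈ A → Member i a) →
       IsAntichain A → OrderAutonomous A → ¬ Nontrivial A) ×
    (∀ x y → blk x ≡ blk y →
       Σ Automorphism λ Φ → InAutD Φ × Automorphism.fun Φ x ≡ y)

  Incomparable : Fin size → Fin size → Set
  Incomparable x y = (x ≢ y) × ¬ (x < y) × ¬ (y < x)

  Restr : Fin blocks → Fin blocks → Set
  Restr C D =
    (∃ λ c₁ → ∃ λ d₁ → Member C c₁ × Member D d₁ × c₁ < d₁) ×
    (∃ λ c₂ → ∃ λ d₂ → Member C c₂ × Member D d₂ × Incomparable c₂ d₂)

-- Automorphisms in Aut_𝒟(P) fix every member of 𝒟 setwise, so transitivity of Aut_𝒟(P)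
-- on C and on D makes every c ∈ C have the same number k of successors in D and every
-- d ∈ D the same number m of predecessors in C.  Counting the pairs c < d of C × D in two
-- ways gives |C| k = |D| m, while C ↾ D gives 0 < k < |D|; so |C| and |D| cannot be
-- coprime, for then |D| would divide k.
-- Counting needs a decidable order; since the goal is decidable, classical reasoning
-- (a double negation) is enough to obtain one.
module Submission where

open import Defs
open import Data.Nat using (ℕ; zero; suc; _<_; _≤_; _*_; z≤n; s≤s; >-nonZero; _<?_)
open import Data.Nat.Properties
  using (*-identityʳ; *-zeroʳ; *-comm; *-monoʳ-≤; +-mono-≤; +-mono-<-≤; +-mono-≤-<;
         <⇒≱; <⇒≢; ≤-<-trans; +-*-semiring; *-commutativeSemigroup)
open import Data.Nat.GCD using (gcd; gcd[m,n]≡0⇒n≡0)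
open import Data.Nat.Coprimality using (gcd≡1⇒coprime; coprime-divisor)
import Data.Nat.Coprimality as Coprimality
open import Data.Nat.Divisibility using (_∣_; divides; ∣⇒≤)
open import Data.Fin using (Fin; zero; suc; _≟_)
open import Data.List using (length; filter; tabulate)
open import Data.Product using (Σ; _×_; _,_)
open import Function using (_∘_)
open import Relation.Nullary using (¬_; Dec; yes; no; contradiction)
open import Relation.Nullary.Decidable using (decidable-stable; ¬¬-excluded-middle)
open import Relation.Nullary.Negation using (¬¬-map)
open import Relation.Binary.PropositionalEquality
open import Algebra.Properties.Semiring.Sum +-*-semiring
  using (sum; sum-cong-≗; ∑-comm; sum-permute; sum-replicate-zero; *-distribˡ-sum; *-distribʳ-sum)
open import Algebra.Properties.CommutativeSemigroup *-commutativeSemigroup using (x∙yz≈y∙xz)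
import Data.Fin.Permutation as Permutation

𝟙 : ∀ {A : Set} → Dec A → ℕ
𝟙 (yes _) = 1
𝟙 (no _)  = 0

𝟙≤1 : ∀ {A : Set} (a? : Dec A) → 𝟙 a? ≤ 1
𝟙≤1 (yes _) = s≤s z≤n
𝟙≤1 (no _)  = z≤n

𝟙-yes : ∀ {A : Set} → A → (a? : Dec A) → 𝟙 a? ≡ 1
𝟙-yes a (yes _) = refl
𝟙-yes a (no ¬a) = contradiction a ¬a

𝟙-no : ∀ {A : Set} → ¬ A → (a? : Dec A) → 𝟙 a? ≡ 0
𝟙-no ¬a (yes a) = contradiction a ¬a
𝟙-no ¬a (no _)  = refl

𝟙-cong : ∀ {A B : Set} (a? : Dec A) (b? : Dec B) → (A → B) → (B → A) → 𝟙 a? ≡ 𝟙 b?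
𝟙-cong (yes _) (yes _) f g = refl
𝟙-cong (yes a) (no ¬b) f g = contradiction (f a) ¬b
𝟙-cong (no ¬a) (yes b) f g = contradiction (g b) ¬a
𝟙-cong (no _)  (no _)  f g = refl

𝟙*-cong : ∀ {A : Set} {x y : ℕ} → (A → x ≡ y) → (a? : Dec A) → 𝟙 a? * x ≡ 𝟙 a? * y
𝟙*-cong x≡y (yes a) = cong (1 *_) (x≡y a)
𝟙*-cong x≡y (no _)  = refl

length-filter-tabulate : ∀ {X : Set} {P : X → Set} (P? : ∀ x → Dec (P x)) n (f : Fin n → X) →
  length (filter P? (tabulate f)) ≡ sum (λ i → 𝟙 (P? (f i)))
length-filter-tabulate P? zero    f = refl
length-filter-tabulate P? (suc n) f with P? (f zero)
... | yes _ = cong suc (length-filter-tabulate P? n (λ i → f (suc i)))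
... | no _  = length-filter-tabulate P? n (λ i → f (suc i))

sum-mono-≤ : ∀ {n} {f g : Fin n → ℕ} → (∀ i → f i ≤ g i) → sum f ≤ sum g
sum-mono-≤ {zero}  f≤g = z≤n
sum-mono-≤ {suc n} f≤g = +-mono-≤ (f≤g zero) (sum-mono-≤ (λ i → f≤g (suc i)))

sum-mono-< : ∀ {n} {f g : Fin n → ℕ} → (∀ i → f i ≤ g i) → ∀ j → f j < g j → sum f < sum g
sum-mono-< f≤g zero    fj<gj = +-mono-<-≤ fj<gj (sum-mono-≤ (λ i → f≤g (suc i)))
sum-mono-< f≤g (suc j) fj<gj = +-mono-≤-< (f≤g zero) (sum-mono-< (λ i → f≤g (suc i)) j fj<gj)

0<sum : ∀ {n} (f : Fin n → ℕ) j → 0 < f j → 0 < sum f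
0<sum {n} f j 0<fj = subst (_< sum f) (sum-replicate-zero n) (sum-mono-< (λ _ → z≤n) j 0<fj)

sum-weighted-rows : ∀ {n} (A B : Fin n → ℕ) (R : Fin n → Fin n → ℕ) {k} →
  (∀ c → A c * sum (λ d → B d * R c d) ≡ A c * k) →
  sum A * k ≡ sum (λ c → sum (λ d → A c * (B d * R c d)))
sum-weighted-rows A B R {k} rows = begin
  sum A * k                                    ≡⟨ *-distribʳ-sum k A ⟩
  sum (λ c → A c * k)                          ≡⟨ sum-cong-≗ (λ c → sym (rows c)) ⟩
  sum (λ c → A c * sum (λ d → B d * R c d))    ≡⟨ sum-cong-≗ (λ c → *-distribˡ-sum (A c) (λ d → B d * R c d)) ⟩
  sum (λ c → sum (λ d → A c * (B d * R c d)))  ∎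
  where open ≡-Reasoning

double-counting : ∀ {n} (A B : Fin n → ℕ) (R : Fin n → Fin n → ℕ) {k m} →
  (∀ c → A c * sum (λ d → B d * R c d) ≡ A c * k) →
  (∀ d → B d * sum (λ c → A c * R c d) ≡ B d * m) →
  sum A * k ≡ sum B * m
double-counting A B R {k} {m} rows columns = begin
  sum A * k                                    ≡⟨ sum-weighted-rows A B R rows ⟩
  sum (λ c → sum (λ d → A c * (B d * R c d)))  ≡⟨ ∑-comm (λ c d → A c * (B d * R c d)) ⟩
  sum (λ d → sum (λ c → A c * (B d * R c d)))  ≡⟨ sum-cong-≗ (λ d → sum-cong-≗ (λ c → x∙yz≈y∙xz (A c) (B d) _)) ⟩
  sum (λ d → sum (λ c → B d * (A c * R c d)))  ≡⟨ sym (sum-weighted-rows B A (λ d c → R c d) columns) ⟩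
  sum B * m                                    ∎
  where open ≡-Reasoning

1<gcd-of-proportion : ∀ a b {k m} → a * k ≡ b * m → 0 < k → k < b → 1 < gcd a b
1<gcd-of-proportion a b {k} {m} ak≡bm 0<k k<b with gcd a b in gcd≡
... | zero        = contradiction (gcd[m,n]≡0⇒n≡0 a gcd≡) (<⇒≢ (≤-<-trans z≤n k<b) ∘ sym)
... | suc zero    = contradiction (∣⇒≤ {{>-nonZero 0<k}} b∣k) (<⇒≱ k<b)
  where
  b∣k : b ∣ k
  b∣k = coprime-divisor (Coprimality.sym (gcd≡1⇒coprime {a} {b} gcd≡))
                        (divides m (trans ak≡bm (*-comm b m)))
... | suc (suc _) = s≤s (s≤s z≤n)

¬¬-∀-Fin : ∀ n {P : Fin n → Set} → (∀ i → ¬ ¬ P i) → ¬ ¬ (∀ i → P i)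
¬¬-∀-Fin zero    ¬¬P ¬∀P = ¬∀P (λ ())
¬¬-∀-Fin (suc n) ¬¬P ¬∀P = ¬¬P zero λ P₀ →
  ¬¬-∀-Fin n (λ i → ¬¬P (suc i)) λ Pₛ → ¬∀P λ { zero → P₀ ; (suc i) → Pₛ i }

module _ (S : StructuredOrderedSet) where
  open StructuredOrderedSet S renaming (_<_ to _≺_)

  AutDTransitive : Set
  AutDTransitive = ∀ x y → blk x ≡ blk y → Σ (Automorphism S) λ Φ → InAutD S Φ × Automorphism.fun Φ x ≡ y

  ¬¬-decidable-order : ¬ ¬ (∀ x y → Dec (x ≺ y))
  ¬¬-decidable-order = ¬¬-∀-Fin size λ x → ¬¬-∀-Fin size λ y → ¬¬-excluded-middle

  module Counting (_<?ₚ_ : ∀ x y → Dec (x ≺ y)) where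

    inBlock : Fin blocks → Fin size → ℕ
    inBlock i x = 𝟙 (blk x ≟ i)

    below : Fin size → Fin size → ℕ
    below c d = 𝟙 (c <?ₚ d)

    successorsIn : Fin blocks → Fin size → ℕ
    successorsIn D c = sum (λ d → inBlock D d * below c d)

    predecessorsIn : Fin blocks → Fin size → ℕ
    predecessorsIn C d = sum (λ c → inBlock C c * below c d)

    card≡sum-inBlock : ∀ i → card S i ≡ sum (inBlock i)
    card≡sum-inBlock i = length-filter-tabulate (λ x → blk x ≟ i) size (λ x → x)

    module _ (Φ : Automorphism S) (Φ∈AutD : InAutD S Φ) where
      open Automorphism Φ

      π : Permutation.Permutation size size
      π = Permutation.permutation fun inv inv-right inv-left

      inBlock-fun : ∀ i x → inBlock i (fun x) ≡ inBlock i x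
      inBlock-fun i x = cong (λ b → 𝟙 (b ≟ i)) (Φ∈AutD x 1)

      below-fun : ∀ c d → below (fun c) (fun d) ≡ below c d
      below-fun c d = 𝟙-cong (fun c <?ₚ fun d) (c <?ₚ d) (refl' c d) (pres c d)

      successorsIn-fun : ∀ D c → successorsIn D (fun c) ≡ successorsIn D c
      successorsIn-fun D c = trans (sum-permute _ π)
        (sum-cong-≗ λ d → cong₂ _*_ (inBlock-fun D d) (below-fun c d))

      predecessorsIn-fun : ∀ C d → predecessorsIn C (fun d) ≡ predecessorsIn C d
      predecessorsIn-fun C d = trans (sum-permute _ π)
        (sum-cong-≗ λ c → cong₂ _*_ (inBlock-fun C c) (below-fun c d))

    module _ (transitive : AutDTransitive) where

      successorsIn-constant : ∀ D {c c′} → blk c ≡ blk c′ → successorsIn D c ≡ successorsIn D c′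
      successorsIn-constant D {c} c~c′ with transitive c _ c~c′
      ... | Φ , Φ∈AutD , refl = sym (successorsIn-fun Φ Φ∈AutD D c)

      predecessorsIn-constant : ∀ C {d d′} → blk d ≡ blk d′ → predecessorsIn C d ≡ predecessorsIn C d′
      predecessorsIn-constant C {d} d~d′ with transitive d _ d~d′
      ... | Φ , Φ∈AutD , refl = sym (predecessorsIn-fun Φ Φ∈AutD C d)

      card*successorsIn≡card*predecessorsIn : ∀ {C D c₀ d₀} → blk c₀ ≡ C → blk d₀ ≡ D →
        card S C * successorsIn D c₀ ≡ card S D * predecessorsIn C d₀
      card*successorsIn≡card*predecessorsIn {C} {D} {c₀} {d₀} c₀∈C d₀∈D = begin
        card S C * successorsIn D c₀        ≡⟨ cong (_* successorsIn D c₀) (card≡sum-inBlock C) ⟩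
        sum (inBlock C) * successorsIn D c₀ ≡⟨ double-counting (inBlock C) (inBlock D) below rows columns ⟩
        sum (inBlock D) * predecessorsIn C d₀ ≡⟨ cong (_* predecessorsIn C d₀) (sym (card≡sum-inBlock D)) ⟩
        card S D * predecessorsIn C d₀      ∎
        where
        open ≡-Reasoning
        rows : ∀ c → inBlock C c * successorsIn D c ≡ inBlock C c * successorsIn D c₀
        rows c = 𝟙*-cong (λ c∈C → successorsIn-constant D (trans c∈C (sym c₀∈C))) (blk c ≟ C)
        columns : ∀ d → inBlock D d * predecessorsIn C d ≡ inBlock D d * predecessorsIn C d₀
        columns d = 𝟙*-cong (λ d∈D → predecessorsIn-constant C (trans d∈D (sym d₀∈D))) (blk d ≟ D)

    0<successorsIn : ∀ {D c d} → blk d ≡ D → c ≺ d → 0 < successorsIn D c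
    0<successorsIn {D} {c} {d} d∈D c<d = 0<sum _ d
      (subst (0 <_) (sym (cong₂ _*_ (𝟙-yes d∈D (blk d ≟ D)) (𝟙-yes c<d (c <?ₚ d)))) (s≤s z≤n))

    successorsIn<card : ∀ {D c d} → blk d ≡ D → ¬ c ≺ d → successorsIn D c < card S D
    successorsIn<card {D} {c} {d} d∈D c≮d = subst (successorsIn D c <_) (sym (card≡sum-inBlock D))
      (sum-mono-< at-most-inBlock d (subst₂ _<_ (sym d-not-counted) (sym (𝟙-yes d∈D (blk d ≟ D))) (s≤s z≤n)))
      where
      at-most-inBlock : ∀ e → inBlock D e * below c e ≤ inBlock D e
      at-most-inBlock e = subst (inBlock D e * below c e ≤_) (*-identityʳ _) (*-monoʳ-≤ (inBlock D e) (𝟙≤1 (c <?ₚ e)))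
      d-not-counted : inBlock D d * below c d ≡ 0
      d-not-counted = trans (cong (inBlock D d *_) (𝟙-no c≮d (c <?ₚ d))) (*-zeroʳ (inBlock D d))

lemma5p4 : (S : StructuredOrderedSet) → Tight S →
    (C D : Fin (StructuredOrderedSet.blocks S)) → Restr S C D →
    1 < gcd (card S C) (card S D)
lemma5p4 S (_ , transitive) C D ((c₁ , d₁ , c₁∈C , d₁∈D , c₁<d₁) , (c₂ , d₂ , c₂∈C , d₂∈D , _ , c₂≮d₂ , _)) =
  decidable-stable (1 <? gcd (card S C) (card S D)) (¬¬-map withDecidableOrder (¬¬-decidable-order S))
  where
  withDecidableOrder : (∀ x y → Dec (StructuredOrderedSet._<_ S x y)) → 1 < gcd (card S C) (card S D)
  withDecidableOrder _<?ₚ_ = 1<gcd-of-proportion (card S C) (card S D)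
    (card*successorsIn≡card*predecessorsIn transitive c₁∈C d₁∈D)
    (0<successorsIn d₁∈D c₁<d₁)
    (subst (_< card S D) (successorsIn-constant transitive D (trans c₂∈C (sym c₁∈C)))
      (successorsIn<card d₂∈D c₂≮d₂))
    where open Counting S _<?ₚ_
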